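{- We have the inclusion of subspaces of $\mathfrak{Lie}(B)$ \[ \mathfrak{stab}_{\mathfrak{Lie}(B)}(\tau)\subset\{\psi\in\mathfrak{Lie}(B)\mid\tau(\pi_0(\psi))=\pi_0(\psi)\}. \]
   Context: Let $B=\{b_0,b_1,b_2,\dots\}$, $\mathbb{Q}\langle B\rangle$ the free associative $\mathbb{Q}$-algebra on $B$, and $\mathfrak{Lie}(B)\subset\mathbb{Q}\langle B\rangle$ the free Lie algebra on $B$. Let $\mathbb{Q}\langle B\rangle^0$ be the span of words not ending in $b_0$ (a subalgebra freely generated by the $b_0^mb_k$, $m\ge0,k\ge1$) and $\pi_0:\mathbb{Q}\langle B\rangle\to\mathbb{Q}\langle B\rangle^0$ the projection killing words ending in $b_0$ and fixing other words. For a word $w=b_0^{m_1}b_{k_1}\cdots b_0^{m_d}b_{k_d}b_0^{m_{d+1}}$ ($d\ge1$, $k_i\ge1$, $m_i\ge0$), $\mathbf{k}=(k_1,\dots,k_d)$ and $\mathbf{l}\in\mathbb{Z}_{>0}^d$, let $w(\mathbf{l})$ be obtained by replacing each $b_{k_i}$ by $b_{l_i}$, $|\mathbf{k}|=\sum k_i$, $\binom{\mathbf{k}-1}{\mathbf{l}-1}=\prod_i\binom{k_i-1}{l_i-1}$, $\mathbf{l}\le\mathbf{k}$ componentwise. Let $\partial_w$ be the derivation of $\mathbb{Q}\langle B\rangle$ with $\partial_w(b_0)=0$ and $\partial_w(b_i)=\sum_{\mathbf{l}\le\mathbf{k}}(-1)^{|\mathbf{k}|+|\mathbf{l}|}\binom{\mathbf{k}-1}{\mathbf{l}-1}[b_{i+|\mathbf{k}|-|\mathbf{l}|},w(\mathbf{l})]$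 for $i\ge1$; if $w=b_0^m$ ($m\ge1$), $\partial_w(b_0)=0$, $\partial_w(b_i)=[b_i,w]$; extend linearly in $w$. For $\psi\in\mathfrak{Lie}(B)$, $\sigma_\psi=\ell_\psi+\partial_\psi$ ($\ell_\psi$ left multiplication) maps $\mathbb{Q}\langle B\rangle b_0$ into itself, and $\sigma^0_\psi$ is the unique linear endomorphism of $\mathbb{Q}\langle B\rangle^0$ with $\pi_0\circ\sigma_\psi=\sigma^0_\psi\circ\pi_0$. $\tau$ is the algebra antiautomorphism of $\mathbb{Q}\langle B\rangle^0$ with $\tau(b_0^mb_k)=b_0^{k-1}b_{m+1}$. $\mathfrak{stab}_{\mathfrak{Lie}(B)}(\tau)=\{\psi\in\mathfrak{Lie}(B)\mid\sigma^0_\psi\circ\tau=\tau\circ\sigma^0_\psi\}$. -}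

module Defs where

open import Data.Nat as ℕ using (ℕ; zero; suc)
open import Data.Nat.Combinatorics using (_C_)
open import Data.Integer using (+_)
open import Data.Rational using (ℚ; 0ℚ; 1ℚ; -_; _/_) renaming (_+_ to _+ℚ_; _*_ to _*ℚ_)
open import Data.List using (List; []; _∷_; _++_; map; concatMap; filter; replicate; upTo; foldr)
open import Data.List.Properties using (≡-dec)
open import Data.Product using (_×_; _,_)
open import Data.Bool using (Bool; true; false; not; if_then_else_)
open import Relation.Binary.PropositionalEquality using (_≡_)
open import Relation.Nullary.Decidable using (does)

-- Words in the alphabet B = {b₀, b₁, …}: the letter bᵢ is the number i.
Word : Set
Word = List ℕ

-- Elements of ℚ⟨B⟩: finite formal ℚ-linear combinations of words,
-- represented as lists of (coefficient , word); equality is ≈ below.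
Poly : Set
Poly = List (ℚ × Word)

coeff : Poly → Word → ℚ
coeff [] w = 0ℚ
coeff ((c , u) ∷ p) w =
  if does (≡-dec ℕ._≟_ u w) then c +ℚ coeff p w else coeff p w

infix 4 _≈_
_≈_ : Poly → Poly → Set
p ≈ q = ∀ w → coeff p w ≡ coeff q w

infixl 6 _⊕_ _⊖_
infixl 7 _⊗_

_⊕_ : Poly → Poly → Poly
p ⊕ q = p ++ q

scale : ℚ → Poly → Poly
scale a = map (λ { (c , u) → (a *ℚ c , u) })

_⊖_ : Poly → Poly → Poly
p ⊖ q = p ⊕ scale (- 1ℚ) q

_⊗_ : Poly → Poly → Poly
p ⊗ q = concatMap (λ { (c , u) → map (λ { (d , v) → (c *ℚ d , u ++ v) }) q }) p

comm : Poly → Poly → Poly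
comm p q = p ⊗ q ⊖ q ⊗ p

word : Word → Poly
word u = (1ℚ , u) ∷ []

letter : ℕ → Poly
letter i = word (i ∷ [])

-- The free Lie algebra 𝔏𝔦𝔢(B) ⊂ ℚ⟨B⟩: the image of Lie expressions
-- (the sub-vector space closed under brackets generated by the bᵢ).
data LieTerm : Set where
  gen  : ℕ → LieTerm
  zer  : LieTerm
  add  : LieTerm → LieTerm → LieTerm
  smul : ℚ → LieTerm → LieTerm
  brk  : LieTerm → LieTerm → LieTerm

⟦_⟧ : LieTerm → Poly
⟦ gen i ⟧ = letter i
⟦ zer ⟧ = []
⟦ add s t ⟧ = ⟦ s ⟧ ⊕ ⟦ t ⟧
⟦ smul a t ⟧ = scale a ⟦ t ⟧
⟦ brk s t ⟧ = comm ⟦ s ⟧ ⟦ t ⟧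

endsInB0 : Word → Bool
endsInB0 [] = false
endsInB0 (zero ∷ []) = true
endsInB0 (suc _ ∷ []) = false
endsInB0 (_ ∷ y ∷ w) = endsInB0 (y ∷ w)

InB0 : Poly → Set
InB0 p = ∀ w → endsInB0 w ≡ true → coeff p w ≡ 0ℚ

π₀ : Poly → Poly
π₀ = filter (λ { (c , u) → not (endsInB0 u) Data.Bool.≟ true })
  where import Data.Bool

-- τ : antiautomorphism of ℚ⟨B⟩⁰, τ(b₀^m b_k) = b₀^(k-1) b_(m+1).
-- On a word not ending in b₀ (a product of blocks b₀^m b_k) it reverses
-- the blocks and transforms each; m counts the pending b₀'s.
τW-go : ℕ → Word → Word
τW-go m [] = []
τW-go m (zero ∷ w) = τW-go (suc m) w
τW-go m (suc k' ∷ w) = τW-go 0 w ++ (replicate k' 0 ++ (suc m ∷ []))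

τW : Word → Word
τW = τW-go 0

-- τ extended linearly (applied to π₀ p, i.e. only to words of ℚ⟨B⟩⁰;
-- it is only ever used on elements of ℚ⟨B⟩⁰)
τ : Poly → Poly
τ p = map (λ { (c , u) → (c , τW u) }) (π₀ p)

ℕtoℚ : ℕ → ℚ
ℕtoℚ n = + n / 1

sign : ℕ → ℚ
sign zero = 1ℚ
sign (suc n) = - sign n

-- For w = b₀^{m₁} b_{k₁} ⋯ b₀^{m_d} b_{k_d} b₀^{m_{d+1}}, the list of
-- triples ((-1)^{|k|+|l|} (k-1 choose l-1) , w(l) , |k|-|l|) over all
-- 1 ≤ l ≤ k.  (For d = 0, i.e. w = b₀^m, this is the single triple
-- (1 , w , 0), so the formula below specialises to ∂_w(bᵢ) = [bᵢ , w].)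
lterms : Word → List (ℚ × Word × ℕ)
lterms [] = (1ℚ , [] , 0) ∷ []
lterms (zero ∷ w) = map (λ { (c , u , s) → (c , zero ∷ u , s) }) (lterms w)
lterms (suc k' ∷ w) =
  concatMap (λ { (c , u , s) →
    map (λ l' → ( sign (k' ℕ.∸ l') *ℚ (ℕtoℚ (k' C l') *ℚ c)
                , suc l' ∷ u
                , (k' ℕ.∸ l') ℕ.+ s ))
        (upTo (suc k')) })
    (lterms w)

∂gen : Word → ℕ → Poly
∂gen w zero = []
∂gen w (suc i') =
  concatMap (λ { (c , u , s) → scale c (comm (letter (suc i' ℕ.+ s)) (word u)) })
            (lterms w)

∂word : Word → Word → Poly
∂word w [] = []
∂word w (a ∷ x) = ∂gen w a ⊗ word x ⊕ letter a ⊗ ∂word w x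

∂ : Poly → Poly → Poly
∂ ψ p = concatMap (λ { (c , x) →
          concatMap (λ { (d , w) → scale (c *ℚ d) (∂word w x) }) ψ }) p

σ : Poly → Poly → Poly
σ ψ p = ψ ⊗ p ⊕ ∂ ψ p

-- σ⁰_ψ on ℚ⟨B⟩⁰: since σ_ψ preserves ℚ⟨B⟩b₀, the unique endomorphism
-- with π₀ ∘ σ_ψ = σ⁰_ψ ∘ π₀ is σ⁰_ψ(p) = π₀(σ_ψ(p)) for p ∈ ℚ⟨B⟩⁰.
σ⁰ : Poly → Poly → Poly
σ⁰ ψ p = π₀ (σ ψ p)

InStabτ : Poly → Set
InStabτ ψ = ∀ p → InB0 p → σ⁰ ψ (τ p) ≈ τ (σ⁰ ψ p)

{-# OPTIONS --safe #-}
module Submission where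

-- Evaluate the defining identity σ⁰_ψ ∘ τ = τ ∘ σ⁰_ψ at the unit 1 of ℚ⟨B⟩⁰:
-- τ(1) = 1, and σ_ψ(1) = ψ because the derivation ∂_ψ kills 1, so both
-- sides collapse to π₀(ψ) and τ(π₀(ψ)).

open import Defs
open import Data.List using ([]; _∷_; _++_)
open import Data.List.Properties using (++-identityʳ)
open import Data.Product using (_,_)
open import Data.Rational.Properties using (*-identityʳ)
open import Relation.Binary.PropositionalEquality using (_≡_; refl; sym; cong; cong₂; module ≡-Reasoning)

one : Poly
one = word []

⊗-identityʳ : (p : Poly) → p ⊗ one ≡ p
⊗-identityʳ [] = refl
⊗-identityʳ ((c , u) ∷ p) =
  cong₂ _∷_ (cong₂ _,_ (*-identityʳ c) (++-identityʳ u)) (⊗-identityʳ p)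

∂-one : (ψ : Poly) → ∂ ψ one ≡ []
∂-one [] = refl
∂-one (_ ∷ ψ) = ∂-one ψ

σ-one : (ψ : Poly) → σ ψ one ≡ ψ
σ-one ψ = begin
  ψ ⊗ one ++ ∂ ψ one  ≡⟨ cong₂ _++_ (⊗-identityʳ ψ) (∂-one ψ) ⟩
  ψ ++ []             ≡⟨ ++-identityʳ ψ ⟩
  ψ                   ∎
  where open ≡-Reasoning

τ-one : τ one ≡ one
τ-one = refl

one-InB0 : InB0 one
one-InB0 [] ()
one-InB0 (_ ∷ _) _ = refl

InStabτ⇒τ-fixes-π₀ : (ψ : Poly) → InStabτ ψ → τ (π₀ ψ) ≈ π₀ ψ
InStabτ⇒τ-fixes-π₀ ψ stab w = begin
  coeff (τ (π₀ ψ)) w              ≡⟨ cong (λ p → coeff (τ (π₀ p)) w) (σ-one ψ) ⟨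
  coeff (τ (σ⁰ ψ one)) w          ≡⟨ stab one one-InB0 w ⟨
  coeff (σ⁰ ψ (τ one)) w          ≡⟨ cong (λ p → coeff (σ⁰ ψ p) w) τ-one ⟩
  coeff (π₀ (σ ψ one)) w          ≡⟨ cong (λ p → coeff (π₀ p) w) (σ-one ψ) ⟩
  coeff (π₀ ψ) w                  ∎
  where open ≡-Reasoning

lemma2p15 : (t : LieTerm) → InStabτ ⟦ t ⟧ → τ (π₀ ⟦ t ⟧) ≈ π₀ ⟦ t ⟧
lemma2p15 t = InStabτ⇒τ-fixes-π₀ ⟦ t ⟧
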